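{- Define $\mathbf{c}=(c_0,c_1,\ldots)$ by $c_0=1$ and $c_{n+1}=c_n+1$ if $(c_n+1)/2$ is not a term of $\mathbf{c}$, $c_{n+1}=c_n+2$ otherwise. For $n\ge 0$ let $P_n$ be the number of Motzkin prefixes of length $n$. Then $P_n$ is even if and only if $n=2c_k-1$ for some $k\in\mathbb{N}$.
   Context: A Motzkin prefix of length $n$ is a lattice path in $\mathbb{N}\times\mathbb{N}$ (so it never goes below the $x$-axis) consisting of $n$ steps, each from $\{(1,1),(1,-1),(1,0)\}$, starting at $(0,0)$, with arbitrary endpoint; equivalently, the first $n$ steps of a Motzkin path of some length $m\ge n$ (a Motzkin path of length $m$ being such a path ending at $(m,0)$). -}

module Defs where

open import Data.Nat using (ℕ; zero; suc; _+_; _*_)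
open import Data.Bool using (Bool; true; false)
open import Data.List using (List; []; _∷_; length; filter; map; concatMap)
open import Data.Maybe using (Maybe; just; nothing; is-just)
open import Relation.Nullary.Decidable using (Dec; yes; no)
open import Relation.Binary.PropositionalEquality using (_≡_)

-- Steps of a Motzkin path: U = (1,1), D = (1,-1), F = (1,0).
data Step : Set where
  U D F : Step

words : ℕ → List (List Step)
words zero    = [] ∷ []
words (suc n) = concatMap (λ w → (U ∷ w) ∷ (D ∷ w) ∷ (F ∷ w) ∷ []) (words n)

walk : ℕ → List Step → Maybe ℕ
walk h []            = just h
walk h (U ∷ s)       = walk (suc h) s
walk h (F ∷ s)       = walk h s
walk zero (D ∷ s)    = nothing
walk (suc h) (D ∷ s) = walk h s

IsMotzkinPrefix : List Step → Set
IsMotzkinPrefix s = is-just (walk 0 s) ≡ true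

isMotzkinPrefix? : (s : List Step) → Dec (IsMotzkinPrefix s)
isMotzkinPrefix? s with is-just (walk 0 s)
... | true  = yes _≡_.refl
... | false = no (λ ())

P : ℕ → ℕ
P n = length (filter isMotzkinPrefix? (words n))

-- Let N n h count the length-n step words that never drop below 0 when started
-- at height h, so P n = N n 0. Modulo 2 the complementary counts, taken from
-- height h + 1, evolve by the reflected trinomial rule f ↦ f(d-1) + f(d) + f(d+1),
-- and since (1 + x + x²)² = 1 + x² + x⁴ over 𝔽₂ the row at time 2k is the row at
-- time k dilated by 2. Reading off height 1 gives that P (2k) is odd and
-- P (2k+1) ≡ P k + 1 (mod 2). So the set S of t + 1 with P t odd contains every
-- odd number and contains 2v exactly when v ∉ S; the rule defining c enumerates
-- S increasingly, hence P n is even iff n = 2u + 1 with u + 1 ∈ S, i.e. n = 2 c k - 1.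

module Submission where

open import Defs
open import Data.Nat
  using (ℕ; zero; suc; pred; _+_; _*_; _∸_; _≤_; _<_; z≤n; s≤s; z<s; parity; >-nonZero)
open import Data.Nat.Properties
  using (_≟_; _≤?_; +-comm; *-comm; *-suc; *-cancelˡ-≡; suc-injective; suc-pred; even≢odd;
         ≤-refl; ≤-trans; ≤-reflexive; <⇒≤; ≤-<-trans; <⇒≱; ≰⇒>; n<1+n; m<n+m; m≤n*m;
         m≤n⇒m<n∨m≡n; m<1+n⇒m<n∨m≡n; m<1+n⇒m≤n)
open import Data.Nat.Divisibility using (_∣_; divides)
open import Data.Nat.ListAction using (sum)
open import Data.Nat.Tactic.RingSolver using (solve-∀)
open import Data.Parity.Base using (Parity; 0ℙ; 1ℙ) renaming (_+_ to _⊕_)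
import Data.Parity.Properties as ℙ
open import Data.Bool using (true; false; if_then_else_)
open import Data.List using (List; []; _∷_; length; filter; map; concatMap)
open import Data.Maybe using (is-just)
open import Data.Product using (∃; _×_; _,_; proj₁; proj₂)
open import Data.Sum using (inj₁; inj₂)
open import Data.Empty using (⊥-elim)
open import Relation.Nullary using (¬_; yes; no)
open import Relation.Binary.PropositionalEquality
  using (_≡_; _≢_; refl; sym; trans; cong; cong₂; subst; module ≡-Reasoning)
open import Function using (_∘_)
open import Function.Bundles using (_⇔_; mk⇔; module Equivalence)
import Function.Properties.Equivalence as ⇔
open import Algebra.Solver.Ring.AlmostCommutativeRing using (fromCommutativeRing)
import Algebra.Solver.Ring.Simple as RingSolver

open ≡-Reasoning
open Equivalence using (to; from)

module ℙ-Solver = RingSolver (fromCommutativeRing ℙ.+-*-commutativeRing) ℙ._≟_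
open ℙ-Solver using (solve; _:+_; _:=_; con)

survives : ℕ → List Step → ℕ
survives h w = if is-just (walk h w) then 1 else 0

survivors : ℕ → List (List Step) → ℕ
survivors h ws = sum (map (survives h) ws)

prefixesFrom : ℕ → ℕ → ℕ
prefixesFrom n h = survivors h (words n)

P≡prefixesFrom-0 : ∀ n → P n ≡ prefixesFrom n 0
P≡prefixesFrom-0 n = filter-prefix≡survivors (words n)
  where
  filter-prefix≡survivors : ∀ ws → length (filter isMotzkinPrefix? ws) ≡ survivors 0 ws
  filter-prefix≡survivors [] = refl
  filter-prefix≡survivors (w ∷ ws) with is-just (walk 0 w)
  ... | true  = cong suc (filter-prefix≡survivors ws)
  ... | false = filter-prefix≡survivors ws

extend : List Step → List (List Step)
extend w = (U ∷ w) ∷ (D ∷ w) ∷ (F ∷ w) ∷ []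

survivors-extend-zero : ∀ ws →
  survivors 0 (concatMap extend ws) ≡ survivors 1 ws + survivors 0 ws
survivors-extend-zero [] = refl
survivors-extend-zero (w ∷ ws) =
  trans (cong (λ r → survives 1 w + (survives 0 w + r)) (survivors-extend-zero ws))
        (regroup (survives 1 w) (survives 0 w) _ _)
  where
  regroup : ∀ a b x y → a + (b + (x + y)) ≡ (a + x) + (b + y)
  regroup = solve-∀

survivors-extend-suc : ∀ h ws → survivors (suc h) (concatMap extend ws)
  ≡ survivors (suc (suc h)) ws + survivors (suc h) ws + survivors h ws
survivors-extend-suc h [] = refl
survivors-extend-suc h (w ∷ ws) =
  trans (cong (λ r → up + (down + (flat + r))) (survivors-extend-suc h ws))
        (regroup up down flat _ _ _)
  where
  up down flat : ℕ
  up   = survives (suc (suc h)) w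
  down = survives h w
  flat = survives (suc h) w
  regroup : ∀ a b c x y z → a + (b + (c + (x + y + z))) ≡ (a + x) + (c + y) + (b + z)
  regroup = solve-∀

prefixesFrom-suc-zero : ∀ n → prefixesFrom (suc n) 0 ≡ prefixesFrom n 1 + prefixesFrom n 0
prefixesFrom-suc-zero n = survivors-extend-zero (words n)

prefixesFrom-suc-suc : ∀ n h → prefixesFrom (suc n) (suc h)
  ≡ prefixesFrom n (suc (suc h)) + prefixesFrom n (suc h) + prefixesFrom n h
prefixesFrom-suc-suc n h = survivors-extend-suc h (words n)

stepRow : (ℕ → Parity) → ℕ → Parity
stepRow f zero    = f zero
stepRow f (suc d) = f d ⊕ f (suc d) ⊕ f (suc (suc d))

-- touching n k is the parity of the number of length-n words that, started at
-- height k, reach height 0; at k = 0 that is all 3ⁿ words.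
touching : ℕ → ℕ → Parity
touching zero    zero    = 1ℙ
touching zero    (suc k) = 0ℙ
touching (suc n)         = stepRow (touching n)

touching-zero : ∀ n → touching n 0 ≡ 1ℙ
touching-zero zero    = refl
touching-zero (suc n) = touching-zero n

parity-prefixesFrom : ∀ n h → parity (prefixesFrom n h) ≡ 1ℙ ⊕ touching n (suc h)
parity-prefixesFrom zero h = refl
parity-prefixesFrom (suc n) zero = begin
  parity (prefixesFrom (suc n) 0) ≡⟨ cong parity (prefixesFrom-suc-zero n) ⟩
  parity (N 1 + N 0)              ≡⟨ ℙ.+-homo-+ (N 1) (N 0) ⟩
  parity (N 1) ⊕ parity (N 0)    ≡⟨ cong₂ _⊕_ (parity-prefixesFrom n 1) (parity-prefixesFrom n 0) ⟩
  (1ℙ ⊕ t 2) ⊕ (1ℙ ⊕ t 1)        ≡⟨ regroup (t 1) (t 2) ⟩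
  1ℙ ⊕ (1ℙ ⊕ t 1 ⊕ t 2)          ≡⟨ cong (λ t₀ → 1ℙ ⊕ (t₀ ⊕ t 1 ⊕ t 2)) (sym (touching-zero n)) ⟩
  1ℙ ⊕ touching (suc n) 1         ∎
  where
  N : ℕ → ℕ
  N = prefixesFrom n
  t : ℕ → Parity
  t = touching n
  regroup : ∀ x y → (1ℙ ⊕ y) ⊕ (1ℙ ⊕ x) ≡ 1ℙ ⊕ (1ℙ ⊕ x ⊕ y)
  regroup = solve 2 (λ x y → (con 1ℙ :+ y) :+ (con 1ℙ :+ x) := con 1ℙ :+ (con 1ℙ :+ x :+ y)) refl
parity-prefixesFrom (suc n) (suc h) = begin
  parity (prefixesFrom (suc n) (suc h))
    ≡⟨ cong parity (prefixesFrom-suc-suc n h) ⟩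
  parity (N (2 + h) + N (1 + h) + N h)
    ≡⟨ ℙ.+-homo-+ (N (2 + h) + N (1 + h)) (N h) ⟩
  parity (N (2 + h) + N (1 + h)) ⊕ parity (N h)
    ≡⟨ cong (_⊕ parity (N h)) (ℙ.+-homo-+ (N (2 + h)) (N (1 + h))) ⟩
  parity (N (2 + h)) ⊕ parity (N (1 + h)) ⊕ parity (N h)
    ≡⟨ cong₂ _⊕_ (cong₂ _⊕_ (parity-prefixesFrom n (2 + h)) (parity-prefixesFrom n (1 + h)))
                 (parity-prefixesFrom n h) ⟩
  (1ℙ ⊕ t (3 + h)) ⊕ (1ℙ ⊕ t (2 + h)) ⊕ (1ℙ ⊕ t (1 + h))
    ≡⟨ regroup (t (1 + h)) (t (2 + h)) (t (3 + h)) ⟩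
  1ℙ ⊕ touching (suc n) (2 + h)  ∎
  where
  N : ℕ → ℕ
  N = prefixesFrom n
  t : ℕ → Parity
  t = touching n
  regroup : ∀ x y z → (1ℙ ⊕ z) ⊕ (1ℙ ⊕ y) ⊕ (1ℙ ⊕ x) ≡ 1ℙ ⊕ (x ⊕ y ⊕ z)
  regroup = solve 3 (λ x y z → (con 1ℙ :+ z) :+ (con 1ℙ :+ y) :+ (con 1ℙ :+ x) := con 1ℙ :+ (x :+ y :+ z)) refl

-- Doubling: two steps of a dilated row are one dilated step

stepRow₂ : (ℕ → Parity) → ℕ → Parity
stepRow₂ f zero          = f 0
stepRow₂ f (suc zero)    = f 3
stepRow₂ f (suc (suc d)) = f d ⊕ f (suc (suc d)) ⊕ f (suc (suc (suc (suc d))))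

stepRow-stepRow : ∀ f d → stepRow (stepRow f) d ≡ stepRow₂ f d
stepRow-stepRow f zero          = refl
stepRow-stepRow f (suc zero)    = regroup (f 0) (f 1) (f 2) (f 3)
  where
  regroup : ∀ a b c e → a ⊕ (a ⊕ b ⊕ c) ⊕ (b ⊕ c ⊕ e) ≡ e
  regroup = solve 4 (λ a b c e → a :+ (a :+ b :+ c) :+ (b :+ c :+ e) := e) refl
stepRow-stepRow f (suc (suc d)) = regroup (f d) (f (1 + d)) (f (2 + d)) (f (3 + d)) (f (4 + d))
  where
  regroup : ∀ a b c e g → (a ⊕ b ⊕ c) ⊕ (b ⊕ c ⊕ e) ⊕ (c ⊕ e ⊕ g) ≡ a ⊕ c ⊕ g
  regroup = solve 5 (λ a b c e g → (a :+ b :+ c) :+ (b :+ c :+ e) :+ (c :+ e :+ g) := a :+ c :+ g) refl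

stepRow₂-cong : ∀ {f g} → (∀ i → f i ≡ g i) → ∀ d → stepRow₂ f d ≡ stepRow₂ g d
stepRow₂-cong f≗g zero          = f≗g 0
stepRow₂-cong f≗g (suc zero)    = f≗g 3
stepRow₂-cong f≗g (suc (suc d)) =
  cong₂ _⊕_ (cong₂ _⊕_ (f≗g d) (f≗g (suc (suc d)))) (f≗g (suc (suc (suc (suc d)))))

dilate : (ℕ → Parity) → ℕ → Parity
dilate g zero          = g zero
dilate g (suc zero)    = 0ℙ
dilate g (suc (suc d)) = dilate (g ∘ suc) d

dilate-0ℙ : ∀ d → dilate (λ _ → 0ℙ) d ≡ 0ℙ
dilate-0ℙ zero          = refl
dilate-0ℙ (suc zero)    = refl
dilate-0ℙ (suc (suc d)) = dilate-0ℙ d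

dilate-⊕ : ∀ f g h d → dilate f d ⊕ dilate g d ⊕ dilate h d ≡ dilate (λ i → f i ⊕ g i ⊕ h i) d
dilate-⊕ f g h zero          = refl
dilate-⊕ f g h (suc zero)    = refl
dilate-⊕ f g h (suc (suc d)) = dilate-⊕ (f ∘ suc) (g ∘ suc) (h ∘ suc) d

stepRow₂-dilate : ∀ g d → stepRow₂ (dilate g) d ≡ dilate (stepRow g) d
stepRow₂-dilate g zero          = refl
stepRow₂-dilate g (suc zero)    = refl
stepRow₂-dilate g (suc (suc d)) = dilate-⊕ g (g ∘ suc) (g ∘ suc ∘ suc) d

touching-double : ∀ k d → touching (2 * k) d ≡ dilate (touching k) d
touching-double zero zero          = refl
touching-double zero (suc zero)    = refl
touching-double zero (suc (suc d)) = sym (dilate-0ℙ d)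
touching-double (suc k) d = begin
  touching (2 * suc k) d                  ≡⟨ cong (λ m → touching m d) (*-suc 2 k) ⟩
  stepRow (stepRow (touching (2 * k))) d  ≡⟨ stepRow-stepRow (touching (2 * k)) d ⟩
  stepRow₂ (touching (2 * k)) d           ≡⟨ stepRow₂-cong (touching-double k) d ⟩
  stepRow₂ (dilate (touching k)) d        ≡⟨ stepRow₂-dilate (touching k) d ⟩
  dilate (touching (suc k)) d             ∎

parity-P : ∀ n → parity (P n) ≡ 1ℙ ⊕ touching n 1
parity-P n = trans (cong parity (P≡prefixesFrom-0 n)) (parity-prefixesFrom n 0)

parity-P-even : ∀ k → parity (P (2 * k)) ≡ 1ℙ
parity-P-even k = trans (parity-P (2 * k)) (cong (1ℙ ⊕_) (touching-double k 1))

parity-P-odd : ∀ k → parity (P (suc (2 * k))) ≡ 1ℙ ⊕ parity (P k)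
parity-P-odd k = begin
  parity (P (suc (2 * k)))         ≡⟨ parity-P (suc (2 * k)) ⟩
  1ℙ ⊕ (t 0 ⊕ t 1 ⊕ t 2)           ≡⟨ cong₂ (λ a b → 1ℙ ⊕ (a ⊕ b ⊕ t 2)) (touching-zero (2 * k)) (touching-double k 1) ⟩
  1ℙ ⊕ (1ℙ ⊕ 0ℙ ⊕ t 2)             ≡⟨ cong (λ b → 1ℙ ⊕ (1ℙ ⊕ b)) (touching-double k 2) ⟩
  1ℙ ⊕ (1ℙ ⊕ touching k 1)         ≡⟨ cong (1ℙ ⊕_) (sym (parity-P k)) ⟩
  1ℙ ⊕ parity (P k)                ∎
  where
  t : ℕ → Parity
  t = touching (2 * k)

-- The sequence c enumerates the shifted indices of odd values of P

0ℙ≢1ℙ : 0ℙ ≢ 1ℙ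
0ℙ≢1ℙ ()

1ℙ⊕p≡0ℙ⇔p≡1ℙ : ∀ p → 1ℙ ⊕ p ≡ 0ℙ ⇔ p ≡ 1ℙ
1ℙ⊕p≡0ℙ⇔p≡1ℙ 0ℙ = mk⇔ (λ ()) (λ ())
1ℙ⊕p≡0ℙ⇔p≡1ℙ 1ℙ = mk⇔ (λ _ → refl) (λ _ → refl)

data EvenOdd : ℕ → Set where
  even : ∀ u → EvenOdd (2 * u)
  odd  : ∀ u → EvenOdd (suc (2 * u))

evenOdd : ∀ n → EvenOdd n
evenOdd zero = even 0
evenOdd (suc n) with evenOdd n
... | even u = odd u
... | odd u  = subst EvenOdd (*-suc 2 u) (even (suc u))

parity-even : ∀ u → parity (2 * u) ≡ 0ℙ
parity-even u = ℙ.*-homo-* 2 u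

parity-odd : ∀ u → parity (suc (2 * u)) ≡ 1ℙ
parity-odd u = trans (ℙ.+-homo-+ 1 (2 * u)) (cong (1ℙ ⊕_) (parity-even u))

2∣⇔parity≡0ℙ : ∀ n → 2 ∣ n ⇔ parity n ≡ 0ℙ
2∣⇔parity≡0ℙ n with evenOdd n
... | even u = mk⇔ (λ _ → parity-even u) (λ _ → divides u (*-comm 2 u))
... | odd u  = mk⇔
  (λ (divides q 1+2u≡q*2) → ⊥-elim (even≢odd q u (sym (trans 1+2u≡q*2 (*-comm q 2)))))
  (λ p → ⊥-elim (0ℙ≢1ℙ (trans (sym p) (parity-odd u))))

module Enumeration (c : ℕ → ℕ) (c₀ : c 0 ≡ 1)
  (rule : ∀ n → ((¬ ∃ λ j → 2 * c j ≡ c n + 1) → c (suc n) ≡ c n + 1)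
              × ((∃ λ j → 2 * c j ≡ c n + 1) → c (suc n) ≡ c n + 2)) where

  InRange : ℕ → Set
  InRange m = ∃ λ j → c j ≡ m

  HalfOfNextInRange : ℕ → Set
  HalfOfNextInRange n = ∃ λ j → 2 * c j ≡ c n + 1

  advance-by-one : ∀ {n} → ¬ HalfOfNextInRange n → c (suc n) ≡ suc (c n)
  advance-by-one {n} ¬half = trans (proj₁ (rule n) ¬half) (+-comm (c n) 1)

  advance-by-two : ∀ {n} → HalfOfNextInRange n → c (suc n) ≡ 2 + c n
  advance-by-two {n} half = trans (proj₂ (rule n) half) (+-comm (c n) 2)

  c-<-suc : ∀ n → c n < c (suc n)
  c-<-suc n with c (suc n) ≟ suc (c n) | c (suc n) ≟ 2 + c n
  ... | yes eq | _      = ≤-reflexive (sym eq)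
  ... | no _   | yes eq = subst (c n <_) (sym eq) (m<n+m (c n) z<s)
  -- HalfOfNextInRange n need not be decidable, but it cannot fail both ways.
  ... | no ≢₁  | no ≢₂  = ⊥-elim (≢₁ (advance-by-one (≢₂ ∘ advance-by-two)))

  c-mono-≤ : ∀ {i j} → i ≤ j → c i ≤ c j
  c-mono-≤ {j = zero} z≤n = ≤-refl
  c-mono-≤ {j = suc j} i≤1+j with m≤n⇒m<n∨m≡n i≤1+j
  ... | inj₁ i<1+j = ≤-trans (c-mono-≤ (m<1+n⇒m≤n i<1+j)) (<⇒≤ (c-<-suc j))
  ... | inj₂ refl  = ≤-refl

  n<c : ∀ n → n < c n
  n<c zero    = subst (0 <_) (sym c₀) z<s
  n<c (suc n) = ≤-<-trans (n<c n) (c-<-suc n)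

  ¬inRange-between : ∀ {n m} → c n < m → m < c (suc n) → ¬ InRange m
  ¬inRange-between {n} cn<m m<cn′ (j , cj≡m) with j ≤? n
  ... | yes j≤n = <⇒≱ cn<m (subst (_≤ c n) cj≡m (c-mono-≤ j≤n))
  ... | no  j≰n = <⇒≱ m<cn′ (subst (c (suc n) ≤_) cj≡m (c-mono-≤ (≰⇒> j≰n)))

  AgreesAt : ℕ → Set
  AgreesAt t = InRange (suc t) ⇔ parity (P t) ≡ 1ℙ

  AgreesBelow : ℕ → Set
  AgreesBelow b = ∀ t → t < b → AgreesAt t

  agreesBelow-suc : ∀ {b} → AgreesBelow b → AgreesAt b → AgreesBelow (suc b)
  agreesBelow-suc below at t t<1+b with m<1+n⇒m<n∨m≡n t<1+b
  ... | inj₁ t<b = below t t<b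
  ... | inj₂ refl = at

  agreesAt-hit : ∀ {j t} → c j ≡ suc t → parity (P t) ≡ 1ℙ → AgreesAt t
  agreesAt-hit cj≡1+t Pt-odd = mk⇔ (λ _ → Pt-odd) (λ _ → _ , cj≡1+t)

  agreesAt-miss : ∀ {t} → ¬ InRange (suc t) → parity (P t) ≡ 0ℙ → AgreesAt t
  agreesAt-miss ∉ Pt-even = mk⇔ (⊥-elim ∘ ∉) (λ Pt-odd → ⊥-elim (0ℙ≢1ℙ (trans (sym Pt-even) Pt-odd)))

  even⇒¬HalfOfNextInRange : ∀ {n u} → c n ≡ 2 * u → ¬ HalfOfNextInRange n
  even⇒¬HalfOfNextInRange {n} {u} cn≡2u (j , 2cj≡cn+1) =
    even≢odd (c j) u (trans 2cj≡cn+1 (trans (cong (_+ 1) cn≡2u) (+-comm (2 * u) 1)))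

  odd⇒HalfOfNextInRange⇔ : ∀ {n u} → c n ≡ suc (2 * u) → HalfOfNextInRange n ⇔ InRange (suc u)
  odd⇒HalfOfNextInRange⇔ {n} {u} cn≡1+2u = mk⇔
    (λ (j , 2cj≡cn+1) → j , *-cancelˡ-≡ (c j) (suc u) 2 (trans 2cj≡cn+1 cn+1≡2[1+u]))
    (λ (j , cj≡1+u) → j , trans (cong (2 *_) cj≡1+u) (sym cn+1≡2[1+u]))
    where
    odd+1 : ∀ u → suc (2 * u) + 1 ≡ 2 * suc u
    odd+1 = solve-∀
    cn+1≡2[1+u] : c n + 1 ≡ 2 * suc u
    cn+1≡2[1+u] = trans (cong (_+ 1) cn≡1+2u) (odd+1 u)

  advance-past : ∀ {n} → AgreesBelow (c n) → c (suc n) ≡ suc (c n) → parity (P (c n)) ≡ 1ℙ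
    → AgreesBelow (c (suc n))
  advance-past below c′≡1+c Pc-odd =
    subst AgreesBelow (sym c′≡1+c) (agreesBelow-suc below (agreesAt-hit c′≡1+c Pc-odd))

  jump-past : ∀ {n} → AgreesBelow (c n) → c (suc n) ≡ 2 + c n
    → parity (P (c n)) ≡ 0ℙ → parity (P (suc (c n))) ≡ 1ℙ → AgreesBelow (c (suc n))
  jump-past {n} below c′≡2+c Pc-even P1+c-odd =
    subst AgreesBelow (sym c′≡2+c)
      (agreesBelow-suc (agreesBelow-suc below (agreesAt-miss skipped Pc-even))
                       (agreesAt-hit c′≡2+c P1+c-odd))
    where
    skipped : ¬ InRange (suc (c n))
    skipped = ¬inRange-between (n<1+n (c n)) (subst (suc (c n) <_) (sym c′≡2+c) (n<1+n (suc (c n))))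

  agreesBelow-step : ∀ n → AgreesBelow (c n) → AgreesBelow (c (suc n))
  agreesBelow-step n below = by-parity (evenOdd (c n)) refl
    where
    by-parity : ∀ {m} → EvenOdd m → c n ≡ m → AgreesBelow (c (suc n))
    by-parity (even u) cn≡2u =
      advance-past below (advance-by-one (even⇒¬HalfOfNextInRange {u = u} cn≡2u))
        (trans (cong (parity ∘ P) cn≡2u) (parity-P-even u))
    by-parity (odd u) cn≡1+2u = by-half-parity (parity (P u)) refl
      where
      u<cn : u < c n
      u<cn = subst (u <_) (sym cn≡1+2u) (s≤s (m≤n*m u 2))
      Pc : parity (P (c n)) ≡ 1ℙ ⊕ parity (P u)
      Pc = trans (cong (parity ∘ P) cn≡1+2u) (parity-P-odd u)
      by-half-parity : ∀ p → parity (P u) ≡ p → AgreesBelow (c (suc n))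
      by-half-parity 0ℙ Pu = advance-past below (advance-by-one ¬half) (trans Pc (cong (1ℙ ⊕_) Pu))
        where
        ¬half : ¬ HalfOfNextInRange n
        ¬half half = 0ℙ≢1ℙ (trans (sym Pu) (to (below u u<cn) (to (odd⇒HalfOfNextInRange⇔ cn≡1+2u) half)))
      by-half-parity 1ℙ Pu = jump-past below (advance-by-two half) (trans Pc (cong (1ℙ ⊕_) Pu)) P1+c
        where
        half : HalfOfNextInRange n
        half = from (odd⇒HalfOfNextInRange⇔ cn≡1+2u) (from (below u u<cn) Pu)
        P1+c : parity (P (suc (c n))) ≡ 1ℙ
        P1+c = trans (cong (parity ∘ P ∘ suc) cn≡1+2u)
                     (trans (cong (parity ∘ P) (sym (*-suc 2 u))) (parity-P-even (suc u)))

  agreesBelow-c : ∀ n → AgreesBelow (c n)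
  agreesBelow-c zero    = subst AgreesBelow (sym c₀) (agreesBelow-suc (λ _ ()) (agreesAt-hit c₀ refl))
  agreesBelow-c (suc n) = agreesBelow-step n (agreesBelow-c n)

  inRange⇔P-odd : ∀ t → InRange (suc t) ⇔ parity (P t) ≡ 1ℙ
  inRange⇔P-odd t = agreesBelow-c t t (n<c t)

  c-suc-pred : ∀ k → c k ≡ suc (pred (c k))
  c-suc-pred k = sym (suc-pred (c k) {{>-nonZero (≤-<-trans z≤n (n<c k))}})

  2*c∸1≡1+2*pred : ∀ k → 2 * c k ∸ 1 ≡ suc (2 * pred (c k))
  2*c∸1≡1+2*pred k =
    trans (cong (λ m → 2 * m ∸ 1) (c-suc-pred k)) (cong (_∸ 1) (*-suc 2 (pred (c k))))

  odd-index⇒c≡ : ∀ {u k} → suc (2 * u) ≡ 2 * c k ∸ 1 → c k ≡ suc u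
  odd-index⇒c≡ {u} {k} 1+2u≡2ck∸1 = trans (c-suc-pred k) (cong suc (sym u≡pred-ck))
    where
    u≡pred-ck : u ≡ pred (c k)
    u≡pred-ck = *-cancelˡ-≡ u (pred (c k)) 2 (suc-injective (trans 1+2u≡2ck∸1 (2*c∸1≡1+2*pred k)))

  inRange⇔odd-index : ∀ u → InRange (suc u) ⇔ (∃ λ k → suc (2 * u) ≡ 2 * c k ∸ 1)
  inRange⇔odd-index u = mk⇔
    (λ (k , ck≡1+u) → k , sym (trans (2*c∸1≡1+2*pred k) (cong (λ m → suc (2 * pred m)) ck≡1+u)))
    (λ (k , e) → k , odd-index⇒c≡ e)

  P-even⇔ : ∀ n → parity (P n) ≡ 0ℙ ⇔ (∃ λ k → n ≡ 2 * c k ∸ 1)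
  P-even⇔ n with evenOdd n
  ... | even u = mk⇔ (λ Pn-even → ⊥-elim (0ℙ≢1ℙ (trans (sym Pn-even) (parity-P-even u))))
                     (λ (k , e) → ⊥-elim (even≢odd u (pred (c k)) (trans e (2*c∸1≡1+2*pred k))))
  ... | odd u rewrite parity-P-odd u =
    ⇔.trans (1ℙ⊕p≡0ℙ⇔p≡1ℙ (parity (P u)))
            (⇔.trans (⇔.sym (inRange⇔P-odd u)) (inRange⇔odd-index u))

corollary3p2 : (c : ℕ → ℕ) → c 0 ≡ 1
    → (∀ n → ((¬ ∃ λ j → 2 * c j ≡ c n + 1) → c (suc n) ≡ c n + 1)
             × ((∃ λ j → 2 * c j ≡ c n + 1) → c (suc n) ≡ c n + 2))
    → ∀ n → (2 ∣ P n) ⇔ (∃ λ k → n ≡ 2 * c k ∸ 1)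
corollary3p2 c c₀ rule n = ⇔.trans (2∣⇔parity≡0ℙ (P n)) (Enumeration.P-even⇔ c c₀ rule n)
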